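{- The axiom system $\mathsf{EK}$ is sound for the language $\mathcal{L}_{E,K}$ with respect to the class of evidence models satisfying condition (E1): every theorem of $\mathsf{EK}$ is true at every evidence scenario of every evidence model satisfying (E1).
   Context: $\mathcal{L}_{E,K}$ is the propositional language over a countable set $\textsc{prop}$ of primitive propositions generated by $\phi ::= p \mid \neg\phi \mid \phi\wedge\psi \mid E\phi \mid K\phi$. An evidence model is a tuple $\mathcal{M}=(X,\mathcal{E},I,v)$ where $X$ is a nonempty set of worlds, $\mathcal{E}$ is a nonempty set of evidence states, $I=\{I_e\}_{e\in\mathcal{E}}$ with each $I_e: X\to 2^X$, and $v:\textsc{prop}\to 2^X$. Let $U_e=\{x\in X : x\in I_e(x)\}$. An evidence scenario is a pair $(x,e)$ with $x\in U_e$. Condition (E1): for all $e\in\mathcal{E}$ and $x,y\in X$, if $y\in I_e(x)$ then $y\in I_e(y)$. Truth at evidence scenarios: $(x,e)\models p$ iff $x\in v(p)$; Boolean connectives as usual; $(x,e)\models E\phi$ iff $I_e(x)\subseteq [\![\phi]\!]^e$; $(x,e)\models K\phi$ iff $\bigcup_{y\in X} I_e(y)\subseteq [\![\phi]\!]^e$, where $[\![\phi]\!]^e=\{y\in U_e : (y,e)\models\phi\}$. The system $\mathsf{EK}$ consists of: all classical propositional tautologies and modus ponens; for $K$ the $\mathsf{S5}$ principles $K(\phi\to\psi)\to(K\phi\to K\psi)$, $K\phi\to\phi$, $K\phi\to KK\phi$, $\neg K\phi\to K\neg K\phi$ and necessitation (from $\vdash\phi$ infer $\vdash K\phi$); for $E$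 the $\mathsf{KT}$ principles $E(\phi\to\psi)\to(E\phi\to E\psi)$, $E\phi\to\phi$ and necessitation for $E$; and the interaction axiom $K\phi\to E\phi$. -}

module Defs where

open import Level using (Level; suc; _⊔_) renaming (zero to lzero)
open import Data.Nat using (ℕ)
open import Data.Bool using (Bool; true; false; not; _∧_)
open import Data.Empty using (⊥)
open import Data.Product using (_×_; Σ)
open import Data.Sum using (_⊎_)
open import Relation.Nullary using (¬_)
open import Relation.Binary.PropositionalEquality using (_≡_)

Prop' : Set
Prop' = ℕ

data Form : Set where
  atom : Prop' → Form
  ¬'_  : Form → Form
  _∧'_ : Form → Form → Form
  E    : Form → Form
  K    : Form → Form

infixr 6 _∧'_
infixr 4 _⇒_

_⇒_ : Form → Form → Form
φ ⇒ ψ = ¬' (φ ∧' ¬' ψ)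

-- Classical propositional tautologies: formulas true under every Boolean
-- valuation in which atoms and modal subformulas (E φ, K φ) are treated
-- as propositional atoms.
evalB : (Form → Bool) → Form → Bool
evalB w (atom p) = w (atom p)
evalB w (¬' φ)   = not (evalB w φ)
evalB w (φ ∧' ψ) = evalB w φ ∧ evalB w ψ
evalB w (E φ)    = w (E φ)
evalB w (K φ)    = w (K φ)

Tautology : Form → Set
Tautology φ = (w : Form → Bool) → evalB w φ ≡ true

data ⊢_ : Form → Set where
  taut  : ∀ {φ} → Tautology φ → ⊢ φ
  mp    : ∀ {φ ψ} → ⊢ (φ ⇒ ψ) → ⊢ φ → ⊢ ψ
  K-K   : ∀ {φ ψ} → ⊢ (K (φ ⇒ ψ) ⇒ (K φ ⇒ K ψ))
  K-T   : ∀ {φ} → ⊢ (K φ ⇒ φ)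
  K-4   : ∀ {φ} → ⊢ (K φ ⇒ K (K φ))
  K-5   : ∀ {φ} → ⊢ (¬' (K φ) ⇒ K (¬' (K φ)))
  K-nec : ∀ {φ} → ⊢ φ → ⊢ K φ
  E-K   : ∀ {φ ψ} → ⊢ (E (φ ⇒ ψ) ⇒ (E φ ⇒ E ψ))
  E-T   : ∀ {φ} → ⊢ (E φ ⇒ φ)
  E-nec : ∀ {φ} → ⊢ φ → ⊢ E φ
  KE    : ∀ {φ} → ⊢ (K φ ⇒ E φ)

record EvidenceModel : Set₁ where
  field
    X       : Set
    Ev      : Set
    x₀      : X          -- X nonempty
    e₀      : Ev         -- 𝓔 nonempty
    I       : Ev → X → X → Set   -- I e x y  means  y ∈ I_e(x)
    v       : Prop' → X → Set    -- v p x    means  x ∈ v(p)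

  U : Ev → X → Set
  U e x = I e x x

  -- truth (x,e) ⊨ φ  (meaningful for evidence scenarios, x ∈ U_e)
  _,_⊨_ : X → Ev → Form → Set
  x , e ⊨ atom p  = v p x
  x , e ⊨ (¬' φ)  = ¬ (x , e ⊨ φ)
  x , e ⊨ (φ ∧' ψ) = (x , e ⊨ φ) × (x , e ⊨ ψ)
  x , e ⊨ E φ     = ∀ y → I e x y → U e y × (y , e ⊨ φ)
  x , e ⊨ K φ     = ∀ z y → I e z y → U e y × (y , e ⊨ φ)

  E1 : Set
  E1 = ∀ e x y → I e x y → I e y y

ExcludedMiddle : Set₁
ExcludedMiddle = (A : Set) → A ⊎ ¬ A

module Submission where

-- Deciding truth at a fixed pair (x, e) (again by excluded
--     middle) gives a Boolean valuation under which evalB computes exactly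
--     truth at (x, e); a tautology is true under it, hence true at (x, e).
--   * Modal principles.  Distribution and the interaction axiom hold at every
--     pair, T needs x ∈ U_e, and (E1) says that every world reachable by some
--     I_e lies in U_e; this is what validates 5 and both necessitation rules,
--     whose semantic clauses demand membership in U_e.

open import Defs
open import Data.Bool using (Bool; true; false; T; not)
open import Data.Bool.Properties using (T-≡; T-∧)
open import Data.Empty using (⊥-elim)
open import Data.Product using (_×_; _,_; proj₁; proj₂)
open import Data.Product.Function.NonDependent.Propositional using (_×-⇔_)
open import Function.Bundles using (_⇔_; mk⇔; Equivalence)
open import Function.Construct.Composition using (_⇔-∘_)
open import Function.Related.TypeIsomorphisms using (¬-cong-⇔)
open import Relation.Nullary using (¬_; Dec; yes; no)
open import Relation.Nullary.Decidable using (⌊_⌋; fromSum; toWitness; fromWitness)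

⇒-intro : {A B : Set} → (A → B) → ¬ (A × ¬ B)
⇒-intro f (a , ¬b) = ¬b (f a)

T-not : {b : Bool} → T (not b) ⇔ (¬ T b)
T-not {true}  = mk⇔ (λ ()) (λ ¬t → ¬t _)
T-not {false} = mk⇔ (λ _ ()) (λ _ → _)

module Classical (lem : ExcludedMiddle) where

  decide : (A : Set) → Dec A
  decide A = fromSum (lem A)

  -- Eliminating ¬(φ ∧ ¬ψ) as an implication needs double-negation elimination.
  ⇒-elim : {A B : Set} → ¬ (A × ¬ B) → A → B
  ⇒-elim {B = B} h a with decide B
  ... | yes b = b
  ... | no ¬b = ⊥-elim (h (a , ¬b))

module Tautologies (lem : ExcludedMiddle) (M : EvidenceModel) where
  open EvidenceModel M
  open Classical lem

  truthValuation : X → Ev → Form → Bool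
  truthValuation x e ψ = ⌊ decide (x , e ⊨ ψ) ⌋

  truthValuation-correct : ∀ x e ψ → T (truthValuation x e ψ) ⇔ (x , e ⊨ ψ)
  truthValuation-correct x e ψ = mk⇔ toWitness fromWitness

  evalB-truthValuation : ∀ x e φ → T (evalB (truthValuation x e) φ) ⇔ (x , e ⊨ φ)
  evalB-truthValuation x e (atom p) = truthValuation-correct x e (atom p)
  evalB-truthValuation x e (¬' φ)   =
    ¬-cong-⇔ (evalB-truthValuation x e φ) ⇔-∘ T-not
  evalB-truthValuation x e (φ ∧' ψ) =
    (evalB-truthValuation x e φ ×-⇔ evalB-truthValuation x e ψ) ⇔-∘ T-∧
  evalB-truthValuation x e (E φ)    = truthValuation-correct x e (E φ)
  evalB-truthValuation x e (K φ)    = truthValuation-correct x e (K φ)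

  tautology-true : ∀ φ → Tautology φ → ∀ x e → x , e ⊨ φ
  tautology-true φ t x e =
    Equivalence.to (evalB-truthValuation x e φ)
      (Equivalence.from T-≡ (t (truthValuation x e)))

module Soundness (lem : ExcludedMiddle) (M : EvidenceModel) (e1 : EvidenceModel.E1 M) where
  open EvidenceModel M
  open Classical lem
  open Tautologies lem M

  Valid : Form → Set
  Valid φ = ∀ e x → U e x → x , e ⊨ φ

  reachable-scenario : ∀ {e z y} → I e z y → U e y
  reachable-scenario {e} {z} {y} = e1 e z y

  K-distribution : ∀ φ ψ x e → x , e ⊨ (K (φ ⇒ ψ) ⇒ (K φ ⇒ K ψ))
  K-distribution φ ψ x e = ⇒-intro λ K[φ⇒ψ] → ⇒-intro λ Kφ z y i →
    proj₁ (Kφ z y i) , ⇒-elim (proj₂ (K[φ⇒ψ] z y i)) (proj₂ (Kφ z y i))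

  E-distribution : ∀ φ ψ x e → x , e ⊨ (E (φ ⇒ ψ) ⇒ (E φ ⇒ E ψ))
  E-distribution φ ψ x e = ⇒-intro λ E[φ⇒ψ] → ⇒-intro λ Eφ y i →
    proj₁ (Eφ y i) , ⇒-elim (proj₂ (E[φ⇒ψ] y i)) (proj₂ (Eφ y i))

  -- Reflexivity: at a scenario, x itself is among the worlds examined.
  K-reflexive : ∀ φ x e → U e x → x , e ⊨ (K φ ⇒ φ)
  K-reflexive φ x e u = ⇒-intro λ Kφ → proj₂ (Kφ x x u)

  E-reflexive : ∀ φ x e → U e x → x , e ⊨ (E φ ⇒ φ)
  E-reflexive φ x e u = ⇒-intro λ Eφ → proj₂ (Eφ x u)

  -- K φ does not depend on the world, so it is positively introspective.
  K-positive : ∀ φ x e → x , e ⊨ (K φ ⇒ K (K φ))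
  K-positive φ x e = ⇒-intro λ Kφ z y i → proj₁ (Kφ z y i) , Kφ

  -- Negative introspection additionally needs the reached worlds to be
  -- scenarios, which (E1) supplies.
  K-negative : ∀ φ x e → x , e ⊨ (¬' (K φ) ⇒ K (¬' (K φ)))
  K-negative φ x e = ⇒-intro λ ¬Kφ z y i → reachable-scenario i , ¬Kφ

  -- I_e(x) is one of the sets quantified over by K.
  K-implies-E : ∀ φ x e → x , e ⊨ (K φ ⇒ E φ)
  K-implies-E φ x e = ⇒-intro λ Kφ y i → Kφ x y i

  -- Necessitation: a valid formula holds at every reachable world, and by
  -- (E1) those worlds are scenarios.
  K-necessitation : ∀ φ → Valid φ → Valid (K φ)
  K-necessitation φ valid e x _ z y i =
    reachable-scenario i , valid e y (reachable-scenario i)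

  E-necessitation : ∀ φ → Valid φ → Valid (E φ)
  E-necessitation φ valid e x _ y i =
    reachable-scenario i , valid e y (reachable-scenario i)

  sound : ∀ {φ} → ⊢ φ → Valid φ
  sound (taut {φ} t)      e x _ = tautology-true φ t x e
  sound (mp d⇒ d)         e x u = ⇒-elim (sound d⇒ e x u) (sound d e x u)
  sound (K-K {φ} {ψ})     e x _ = K-distribution φ ψ x e
  sound (K-T {φ})         e x u = K-reflexive φ x e u
  sound (K-4 {φ})         e x _ = K-positive φ x e
  sound (K-5 {φ})         e x _ = K-negative φ x e
  sound (K-nec {φ} d)           = K-necessitation φ (sound d)
  sound (E-K {φ} {ψ})     e x _ = E-distribution φ ψ x e
  sound (E-T {φ})         e x u = E-reflexive φ x e u
  sound (E-nec {φ} d)           = E-necessitation φ (sound d)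
  sound (KE {φ})          e x _ = K-implies-E φ x e

theorem1 : ExcludedMiddle → (M : EvidenceModel) → EvidenceModel.E1 M →
           ∀ {φ} → ⊢ φ →
           ∀ (e : EvidenceModel.Ev M) (x : EvidenceModel.X M) →
           EvidenceModel.U M e x → EvidenceModel._,_⊨_ M x e φ
theorem1 lem M e1 = Soundness.sound lem M e1
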